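{- Let $n\geq 600$ and let $G$ be a graph on $2n+1$ vertices with at least $n^2+n$ edges, such that $G$ contains no two vertices of the same degree joined by a path of length three, and $G$ is not $K_{n,n+1}$. Then the maximum degree $\Delta$ of $G$ satisfies $\Delta< n+\sqrt{2n}+\frac{3}{2}$.
   Context: Graphs are finite and simple. A path of length three is a path with three edges on four distinct vertices; its endpoints are said to be joined by it. -}

module Defs where

open import Data.Nat using (ℕ; _+_; _*_; _∸_; _^_; _<_; _⊔_; _<ᵇ_)
open import Data.Fin using (Fin; toℕ)
open import Data.Bool using (Bool; true; false; _∧_; _xor_; T)
open import Data.List using (List; length; filterᵇ; allFin; map; foldr)
open import Data.Nat.ListAction using (sum)
open import Data.Product using (Σ; _×_; ∃)
open import Function.Bundles using (_⤖_; Bijection)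
open import Relation.Binary.PropositionalEquality using (_≡_; _≢_)
open import Relation.Nullary using (¬_)

record Graph (m : ℕ) : Set where
  field
    adj   : Fin m → Fin m → Bool
    sym   : ∀ u v → adj u v ≡ adj v u
    irrefl : ∀ v → adj v v ≡ false
open Graph public

_~[_]_ : ∀ {m} → Fin m → Graph m → Fin m → Set
u ~[ G ] v = T (adj G u v)

degree : ∀ {m} → Graph m → Fin m → ℕ
degree {m} G v = length (filterᵇ (adj G v) (allFin m))

maxDegree : ∀ {m} → Graph m → ℕ
maxDegree {m} G = foldr _⊔_ 0 (map (degree G) (allFin m))

edgeCount : ∀ {m} → Graph m → ℕ
edgeCount {m} G =
  sum (map (λ u → length (filterᵇ (λ v → (toℕ u <ᵇ toℕ v) ∧ adj G u v) (allFin m)))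
           (allFin m))

JoinedByP3 : ∀ {m} → Graph m → Fin m → Fin m → Set
JoinedByP3 {m} G a d =
  Σ (Fin m) λ b → Σ (Fin m) λ c →
    (a ≢ b) × (a ≢ c) × (a ≢ d) × (b ≢ c) × (b ≢ d) × (c ≢ d) ×
    (a ~[ G ] b) × (b ~[ G ] c) × (c ~[ G ] d)

-- the complete bipartite graph K_{n,n+1} on the vertex set Fin (2n+1):
-- parts {i | i < n} (size n) and {i | n ≤ i} (size n+1);
-- u ~ v iff exactly one of u, v lies in the first part
KBip-adj : (n : ℕ) → Fin (2 * n + 1) → Fin (2 * n + 1) → Bool
KBip-adj n u v = (toℕ u <ᵇ n) xor (toℕ v <ᵇ n)

IsomorphicTo : ∀ {m} → Graph m → (Fin m → Fin m → Bool) → Set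
IsomorphicTo {m} G H =
  Σ (Fin m ⤖ Fin m) λ f →
    ∀ u v → adj G u v ≡ H (Bijection.to f u) (Bijection.to f v)

IsKnn1 : (n : ℕ) → Graph (2 * n + 1) → Set
IsKnn1 n G = IsomorphicTo G (KBip-adj n)

{-# OPTIONS --safe #-}
module Submission where

-- Let v be a vertex of maximum degree D, A its neighbourhood, c = 2n + 1 − D the number of
-- non-neighbours of v (v included) and e the number of edges.  If two vertices i, j of A have
-- the same degree, then j is the only possible neighbour of i inside A (a second one, x, would
-- give the path j v x i), so i has degree at most c + 1.  Hence the excesses deg w − c of the
-- vertices w ∈ A take every value ≥ 2 at most once and the value 1 at most twice.
-- If no vertex of A has degree D, the excesses are at most K = D − c − 1, and bounding the
-- degrees outside A by D gives 2e ≤ 2cD + ∑ excess ≤ 2cD + (K² + K)/2 + 1.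
-- If some y ∈ A has degree D, every neighbour of y outside A other than v has y as its only
-- neighbour inside A, hence degree at most c; as deg y = deg v there are as many of them as
-- vertices of A not adjacent to y, and weighing these two sets against each other gives
-- 2e ≤ 2cD + (D − c) + 2.  With D = n + 1 + t we have D − c = 2t + 1 and
-- n(n + 1) = cD + t(t + 1), so 2e ≥ 2n(n + 1) forces t ≤ 1 in both cases: in fact Δ ≤ n + 2.

open import Defs hiding (sym)
open import Data.Bool using (Bool; true; false; T; not; _∧_; if_then_else_)
open import Data.Bool.Properties using (∧-comm; T-∧; T-≡)
open import Data.Empty using (⊥; ⊥-elim)
open import Data.Fin using (Fin; zero; suc; toℕ; _≟_)
open import Data.Fin.Properties using (any?)
import Data.Fin.Properties as Finₚ
open import Data.List using (List; []; _∷_; length; filterᵇ; allFin; map; tabulate)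
open import Data.List.Properties using (map-tabulate; foldr-preservesᵒ)
open import Data.List.Membership.Propositional.Properties
  using (foldr-selective; ∈-map⁺; ∈-map⁻; ∈-allFin)
import Data.List.Relation.Unary.Any as Any
import Data.Nat.ListAction as List
open import Data.Nat hiding (_≟_)
open import Data.Nat.Properties hiding (_≟_)
import Data.Nat.Properties as ℕ
open import Algebra.Properties.Semiring.Sum +-*-semiring
  using (∑-distrib-+; ∑-comm; sum-cong-≗; sum-replicate-zero; *-distribʳ-sum)
  renaming (sum to ∑)
open import Data.Nat.Tactic.RingSolver using (solve-∀)
open import Data.Product using (_×_; _,_; proj₁; proj₂; ∃-syntax)
open import Data.Sum using (_⊎_; inj₁; inj₂; [_,_])
open import Data.Unit using (tt)
open import Function using (_∘_; id)
open import Function.Bundles using (Equivalence)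
open import Relation.Binary.PropositionalEquality hiding ([_])
open import Relation.Nullary using (¬_; yes; no)
open import Relation.Nullary.Decidable using (T?; _×-dec_; ⌊_⌋; toWitness)

private
  variable
    A : Set
    m : ℕ

𝟙 : Bool → ℕ
𝟙 true  = 1
𝟙 false = 0

count : (Fin m → Bool) → ℕ
count p = ∑ (λ x → 𝟙 (p x))

AtMostOne : (Fin m → Set) → Set
AtMostOne P = ∀ {x y} → x ≢ y → P x → P y → ⊥

AtMostTwo : (Fin m → Set) → Set
AtMostTwo P = ∀ {x y z} → x ≢ y → x ≢ z → y ≢ z → P x → P y → P z → ⊥

T-≡true : ∀ {b} → b ≡ true → T b
T-≡true = Equivalence.from T-≡

T-∧ˡ : ∀ {a b} → T (a ∧ b) → T a
T-∧ˡ = proj₁ ∘ Equivalence.to T-∧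

T-∧ʳ : ∀ {a b} → T (a ∧ b) → T b
T-∧ʳ = proj₂ ∘ Equivalence.to T-∧

𝟙-mono : ∀ {a b} → (T a → T b) → 𝟙 a ≤ 𝟙 b
𝟙-mono {false}         _   = z≤n
𝟙-mono {true}  {true}  _   = ≤-refl
𝟙-mono {true}  {false} a⇒b = ⊥-elim (a⇒b tt)

𝟙-mono-< : ∀ {a b} → ¬ T a → T b → 𝟙 a < 𝟙 b
𝟙-mono-< {false} {true} _  _ = ≤-refl
𝟙-mono-< {true}         ¬a _ = ⊥-elim (¬a tt)

𝟙-false : ∀ {a} → ¬ T a → 𝟙 a ≡ 0
𝟙-false {false} _  = refl
𝟙-false {true}  ¬a = ⊥-elim (¬a tt)

∑-mono : {f g : Fin m → ℕ} → (∀ i → f i ≤ g i) → ∑ f ≤ ∑ g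
∑-mono {zero}  _   = z≤n
∑-mono {suc m} f≤g = +-mono-≤ (f≤g zero) (∑-mono (f≤g ∘ suc))

∑-zero : {f : Fin m → ℕ} → (∀ i → f i ≡ 0) → ∑ f ≡ 0
∑-zero {m} f≡0 = trans (sum-cong-≗ f≡0) (sum-replicate-zero m)

∑-if-0 : (p : Fin m → Bool) (a : ℕ) → ∑ (λ x → if p x then a else 0) ≡ count p * a
∑-if-0 p a = trans (sum-cong-≗ (λ x → if≡𝟙* (p x))) (sym (*-distribʳ-sum a (𝟙 ∘ p)))
  where
  if≡𝟙* : ∀ b → (if b then a else 0) ≡ 𝟙 b * a
  if≡𝟙* true  = sym (+-identityʳ a)
  if≡𝟙* false = refl

∑-if : (p : Fin m → Bool) (a b : ℕ) →
       ∑ (λ x → if p x then a else b) ≡ count p * a + count (not ∘ p) * b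
∑-if p a b = begin
  ∑ (λ x → if p x then a else b)
    ≡⟨ sum-cong-≗ (λ x → split (p x)) ⟩
  ∑ (λ x → (if p x then a else 0) + (if not (p x) then b else 0))
    ≡⟨ ∑-distrib-+ (λ x → if p x then a else 0) (λ x → if not (p x) then b else 0) ⟩
  ∑ (λ x → if p x then a else 0) + ∑ (λ x → if not (p x) then b else 0)
    ≡⟨ cong₂ _+_ (∑-if-0 p a) (∑-if-0 (not ∘ p) b) ⟩
  count p * a + count (not ∘ p) * b ∎
  where
  open ≡-Reasoning
  split : ∀ c → (if c then a else b) ≡ (if c then a else 0) + (if not c then b else 0)
  split true  = sym (+-identityʳ a)
  split false = refl

count-all : count {m} (λ _ → true) ≡ m
count-all {zero}  = refl
count-all {suc m} = cong suc count-all

count-mono : {p q : Fin m → Bool} → (∀ x → T (p x) → T (q x)) → count p ≤ count q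
count-mono p⇒q = ∑-mono (λ x → 𝟙-mono (p⇒q x))

count-mono-< : {p q : Fin m → Bool} (t : Fin m) →
               (∀ x → T (p x) → T (q x)) → ¬ T (p t) → T (q t) → count p < count q
count-mono-< zero    p⇒q ¬pt qt = +-mono-<-≤ (𝟙-mono-< ¬pt qt) (count-mono (p⇒q ∘ suc))
count-mono-< (suc t) p⇒q ¬pt qt = +-mono-≤-< (𝟙-mono (p⇒q zero)) (count-mono-< t (p⇒q ∘ suc) ¬pt qt)

count-none : {p : Fin m → Bool} → (∀ x → ¬ T (p x)) → count p ≡ 0
count-none ¬p = ∑-zero (λ x → 𝟙-false (¬p x))

count-atMostOne : (p : Fin m → Bool) → AtMostOne (T ∘ p) → count p ≤ 1
count-atMostOne {zero}  p _ = z≤n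
count-atMostOne {suc m} p once with p zero in p0
... | true  = s≤s (≤-reflexive (count-none {p = p ∘ suc} (λ x → once (λ ()) (T-≡true p0))))
... | false = count-atMostOne (p ∘ suc) (λ x≢y → once (x≢y ∘ Finₚ.suc-injective))

count-atMostTwo : (p : Fin m → Bool) → AtMostTwo (T ∘ p) → count p ≤ 2
count-atMostTwo {zero}  p _ = z≤n
count-atMostTwo {suc m} p twice with p zero in p0
... | true  = s≤s (count-atMostOne (p ∘ suc)
                     (λ x≢y → twice (λ ()) (λ ()) (x≢y ∘ Finₚ.suc-injective) (T-≡true p0)))
... | false = count-atMostTwo (p ∘ suc) (λ x≢y x≢z y≢z →
                twice (x≢y ∘ Finₚ.suc-injective) (x≢z ∘ Finₚ.suc-injective)
                      (y≢z ∘ Finₚ.suc-injective))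

count-split : (p q : Fin m → Bool) →
              count p ≡ count (λ x → p x ∧ q x) + count (λ x → p x ∧ not (q x))
count-split p q = trans (sum-cong-≗ (λ x → split (p x) (q x)))
                        (∑-distrib-+ (λ x → 𝟙 (p x ∧ q x)) (λ x → 𝟙 (p x ∧ not (q x))))
  where
  split : ∀ a b → 𝟙 a ≡ 𝟙 (a ∧ b) + 𝟙 (a ∧ not b)
  split false _     = refl
  split true  true  = refl
  split true  false = refl

count-not+count : (p : Fin m → Bool) → count (not ∘ p) + count p ≡ m
count-not+count p = trans (sym (∑-distrib-+ (λ x → 𝟙 (not (p x))) (λ x → 𝟙 (p x))))
                          (trans (sum-cong-≗ (λ x → cover (p x))) count-all)
  where
  cover : ∀ b → 𝟙 (not b) + 𝟙 b ≡ 1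
  cover true  = refl
  cover false = refl

count-∖-sym : (p q : Fin m → Bool) → count p ≡ count q →
              count (λ x → p x ∧ not (q x)) ≡ count (λ x → q x ∧ not (p x))
count-∖-sym p q ∣p∣≡∣q∣ = +-cancelˡ-≡ (count (λ x → p x ∧ q x)) _ _ (begin
  count (λ x → p x ∧ q x) + count (λ x → p x ∧ not (q x)) ≡⟨ count-split p q ⟨
  count p                                                 ≡⟨ ∣p∣≡∣q∣ ⟩
  count q                                                 ≡⟨ count-split q p ⟩
  count (λ x → q x ∧ p x) + count (λ x → q x ∧ not (p x)) ≡⟨ cong (_+ count q∖p) ∣q∧p∣≡∣p∧q∣ ⟩
  count (λ x → p x ∧ q x) + count (λ x → q x ∧ not (p x)) ∎)
  where
  open ≡-Reasoning
  q∖p : Fin _ → Bool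
  q∖p x = q x ∧ not (p x)
  ∣q∧p∣≡∣p∧q∣ : count (λ x → q x ∧ p x) ≡ count (λ x → p x ∧ q x)
  ∣q∧p∣≡∣p∧q∣ = sum-cong-≗ (λ x → cong 𝟙 (∧-comm (q x) (p x)))

NearlyInjective : (Fin m → ℕ) → Set
NearlyInjective h = (∀ k → AtMostOne (λ i → h i ≡ 2 + k)) × AtMostTwo (λ i → h i ≡ 1)

∑≤2 : (h : Fin m → ℕ) → (∀ i → h i ≤ 1) → AtMostTwo (λ i → h i ≡ 1) → ∑ h ≤ 2
∑≤2 h h≤1 twice = begin
  ∑ h                      ≡⟨ sum-cong-≗ (λ i → ≤1⇒≡𝟙 (h≤1 i)) ⟩
  count (λ i → h i ≡ᵇ 1)   ≤⟨ count-atMostTwo (λ i → h i ≡ᵇ 1) (λ x≢y x≢z y≢z hx hy hz →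
                                twice x≢y x≢z y≢z (≡ᵇ⇒≡ _ 1 hx) (≡ᵇ⇒≡ _ 1 hy) (≡ᵇ⇒≡ _ 1 hz)) ⟩
  2                        ∎
  where
  open ≤-Reasoning
  ≤1⇒≡𝟙 : ∀ {k} → k ≤ 1 → k ≡ 𝟙 (k ≡ᵇ 1)
  ≤1⇒≡𝟙 z≤n       = refl
  ≤1⇒≡𝟙 (s≤s z≤n) = refl

removeValue : ℕ → (Fin m → ℕ) → Fin m → ℕ
removeValue k h i = if h i ≡ᵇ k then 0 else h i

∑-removeValue : (k : ℕ) (h : Fin m → ℕ) →
                ∑ h ≡ ∑ (removeValue k h) + count (λ i → h i ≡ᵇ k) * k
∑-removeValue k h = begin
  ∑ h
    ≡⟨ sum-cong-≗ (λ i → split (h i)) ⟩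
  ∑ (λ i → removeValue k h i + (if h i ≡ᵇ k then k else 0))
    ≡⟨ ∑-distrib-+ (removeValue k h) (λ i → if h i ≡ᵇ k then k else 0) ⟩
  ∑ (removeValue k h) + ∑ (λ i → if h i ≡ᵇ k then k else 0)
    ≡⟨ cong (∑ (removeValue k h) +_) (∑-if-0 (λ i → h i ≡ᵇ k) k) ⟩
  ∑ (removeValue k h) + count (λ i → h i ≡ᵇ k) * k ∎
  where
  open ≡-Reasoning
  split : ∀ n → n ≡ (if n ≡ᵇ k then 0 else n) + (if n ≡ᵇ k then k else 0)
  split n with n ≡ᵇ k in n≡k
  ... | true  = ≡ᵇ⇒≡ n k (T-≡true n≡k)
  ... | false = sym (+-identityʳ n)

removeValue-suc : ∀ {k e} (h : Fin m → ℕ) i → removeValue k h i ≡ suc e → h i ≡ suc e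
removeValue-suc {k = k} h i with h i ≡ᵇ k
... | true  = λ ()
... | false = λ eq → eq

removeValue-≤ : ∀ {b} (h : Fin m → ℕ) → (∀ i → h i ≤ suc b) → ∀ i → removeValue (suc b) h i ≤ b
removeValue-≤ {b = b} h h≤ i with h i ≡ᵇ suc b in hi≢
... | true  = z≤n
... | false = ≤-pred (≤∧≢⇒< (h≤ i) (λ eq → subst T hi≢ (≡⇒≡ᵇ _ _ eq)))

removeValue-nearlyInjective : ∀ {k} (h : Fin m → ℕ) → NearlyInjective h →
                              NearlyInjective (removeValue k h)
removeValue-nearlyInjective h (once , twice) =
  (λ k x≢y hx hy → once k x≢y (removeValue-suc h _ hx) (removeValue-suc h _ hy)) ,
  (λ x≢y x≢z y≢z hx hy hz →
     twice x≢y x≢z y≢z (removeValue-suc h _ hx) (removeValue-suc h _ hy) (removeValue-suc h _ hz))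

-- The extreme case takes the value 1 twice and each of 2, …, b once: 2 + (2 + ⋯ + b).
∑-nearlyInjective : (b : ℕ) (h : Fin m → ℕ) → (∀ i → h i ≤ b) → NearlyInjective h →
                    2 * ∑ h ≤ b * suc b + 2
∑-nearlyInjective zero          h h≤0 _           =
  ≤-trans (≤-reflexive (cong (2 *_) (∑-zero (λ i → n≤0⇒n≡0 (h≤0 i))))) z≤n
∑-nearlyInjective (suc zero)    h h≤1 (_ , twice) = *-monoʳ-≤ 2 (∑≤2 h h≤1 twice)
∑-nearlyInjective {m} (suc (suc b)) h h≤ inj@(once , _) = begin
  2 * ∑ h
    ≡⟨ cong (2 *_) (∑-removeValue k h) ⟩
  2 * (∑ h′ + count (λ i → h i ≡ᵇ k) * k)
    ≤⟨ *-monoʳ-≤ 2 (+-monoʳ-≤ (∑ h′) (*-monoˡ-≤ k atMostOnce)) ⟩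
  2 * (∑ h′ + 1 * k)
    ≡⟨ *-distribˡ-+ 2 (∑ h′) (1 * k) ⟩
  2 * ∑ h′ + 2 * (1 * k)
    ≤⟨ +-monoˡ-≤ (2 * (1 * k)) (∑-nearlyInjective (suc b) h′ h′≤ inj′) ⟩
  suc b * suc (suc b) + 2 + 2 * (1 * k)
    ≡⟨ arithmetic b ⟩
  k * suc k + 2 ∎
  where
  open ≤-Reasoning
  k : ℕ
  k = suc (suc b)
  h′ : Fin m → ℕ
  h′ = removeValue k h
  h′≤ : ∀ i → h′ i ≤ suc b
  h′≤ = removeValue-≤ h h≤
  inj′ : NearlyInjective h′
  inj′ = removeValue-nearlyInjective h inj
  atMostOnce : count (λ i → h i ≡ᵇ k) ≤ 1
  atMostOnce = count-atMostOne (λ i → h i ≡ᵇ k)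
    (λ x≢y hx hy → once b x≢y (≡ᵇ⇒≡ _ k hx) (≡ᵇ⇒≡ _ k hy))
  arithmetic : ∀ b → suc b * suc (suc b) + 2 + 2 * (1 * suc (suc b))
                     ≡ suc (suc b) * suc (suc (suc b)) + 2
  arithmetic = solve-∀

~-sym : (G : Graph m) {u w : Fin m} → u ~[ G ] w → w ~[ G ] u
~-sym G {u} {w} = subst T (Graph.sym G u w)

~⇒≢ : (G : Graph m) {u w : Fin m} → u ~[ G ] w → u ≢ w
~⇒≢ G {u} u~u refl = subst T (irrefl G u) u~u

sum-tabulate : (f : Fin m → ℕ) → List.sum (tabulate f) ≡ ∑ f
sum-tabulate {zero}  f = refl
sum-tabulate {suc m} f = cong (f zero +_) (sum-tabulate (f ∘ suc))

sum-map-allFin : (f : Fin m → ℕ) → List.sum (map f (allFin m)) ≡ ∑ f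
sum-map-allFin f = trans (cong List.sum (map-tabulate id f)) (sum-tabulate f)

length-filterᵇ : (p : A → Bool) (xs : List A) → length (filterᵇ p xs) ≡ List.sum (map (𝟙 ∘ p) xs)
length-filterᵇ p []       = refl
length-filterᵇ p (x ∷ xs) with p x
... | true  = cong suc (length-filterᵇ p xs)
... | false = length-filterᵇ p xs

length-filterᵇ-allFin : (p : Fin m → Bool) → length (filterᵇ p (allFin m)) ≡ count p
length-filterᵇ-allFin {m} p = trans (length-filterᵇ p (allFin m)) (sum-map-allFin (𝟙 ∘ p))

degree≡count : (G : Graph m) (v : Fin m) → degree G v ≡ count (adj G v)
degree≡count G v = length-filterᵇ-allFin (adj G v)

adj< : Graph m → Fin m → Fin m → Bool
adj< G u w = (toℕ u <ᵇ toℕ w) ∧ adj G u w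

edgeCount≡∑ : (G : Graph m) → edgeCount G ≡ ∑ (λ u → count (adj< G u))
edgeCount≡∑ {m} G = trans (sum-map-allFin (λ u → length (filterᵇ (adj< G u) (allFin m))))
                          (sum-cong-≗ (λ u → length-filterᵇ-allFin (adj< G u)))

adj-split : (G : Graph m) (u w : Fin m) → 𝟙 (adj G u w) ≡ 𝟙 (adj< G u w) + 𝟙 (adj< G w u)
adj-split G u w with toℕ u <ᵇ toℕ w in u<w | toℕ w <ᵇ toℕ u in w<u
... | true  | true  = ⊥-elim (<-asym (<ᵇ⇒< (toℕ u) (toℕ w) (T-≡true u<w))
                                    (<ᵇ⇒< (toℕ w) (toℕ u) (T-≡true w<u)))
... | true  | false = sym (+-identityʳ _)
... | false | true  = cong 𝟙 (Graph.sym G u w)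
... | false | false = cong 𝟙 (adj-diagonal (Finₚ.toℕ-injective
                        (≤-antisym (≮⇒≥ (≮ (toℕ w) (toℕ u) w<u)) (≮⇒≥ (≮ (toℕ u) (toℕ w) u<w)))))
  where
  ≮ : ∀ a b → (a <ᵇ b) ≡ false → ¬ a < b
  ≮ _ _ a≮b a<b = subst T a≮b (<⇒<ᵇ a<b)
  adj-diagonal : u ≡ w → adj G u w ≡ false
  adj-diagonal refl = irrefl G u

handshake : (G : Graph m) → ∑ (degree G) ≡ 2 * edgeCount G
handshake G = begin
  ∑ (degree G)
    ≡⟨ sum-cong-≗ (λ u → trans (degree≡count G u) (sum-cong-≗ (adj-split G u))) ⟩
  ∑ (λ u → ∑ (λ w → 𝟙 (adj< G u w) + 𝟙 (adj< G w u)))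
    ≡⟨ sum-cong-≗ (λ u → ∑-distrib-+ (λ w → 𝟙 (adj< G u w)) (λ w → 𝟙 (adj< G w u))) ⟩
  ∑ (λ u → count (adj< G u) + ∑ (λ w → 𝟙 (adj< G w u)))
    ≡⟨ ∑-distrib-+ (λ u → count (adj< G u)) (λ u → ∑ (λ w → 𝟙 (adj< G w u))) ⟩
  ∑ (λ u → count (adj< G u)) + ∑ (λ u → ∑ (λ w → 𝟙 (adj< G w u)))
    ≡⟨ cong (∑ (λ u → count (adj< G u)) +_) (∑-comm (λ u w → 𝟙 (adj< G w u))) ⟩
  ∑ (λ u → count (adj< G u)) + ∑ (λ w → count (adj< G w))
    ≡⟨ cong₂ _+_ (edgeCount≡∑ G) (edgeCount≡∑ G) ⟨
  edgeCount G + edgeCount G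
    ≡⟨ cong (edgeCount G +_) (+-identityʳ (edgeCount G)) ⟨
  2 * edgeCount G ∎
  where open ≡-Reasoning

maxDegree-attained : (G : Graph m) → maxDegree G ≡ 0 ⊎ ∃[ v ] degree G v ≡ maxDegree G
maxDegree-attained {m} G with foldr-selective ⊔-sel 0 (map (degree G) (allFin m))
... | inj₁ Δ≡0 = inj₁ Δ≡0
... | inj₂ Δ∈  with ∈-map⁻ (degree G) Δ∈
...   | v , _ , Δ≡deg = inj₂ (v , sym Δ≡deg)

degree≤maxDegree : (G : Graph m) (w : Fin m) → degree G w ≤ maxDegree G
degree≤maxDegree {m} G w =
  foldr-preservesᵒ (λ x y → [ m≤n⇒m≤n⊔o y , m≤n⇒m≤o⊔n x ]) 0 (map (degree G) (allFin m))
    (inj₂ (Any.map ≤-reflexive (∈-map⁺ (degree G) (∈-allFin w))))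

NoEqualDegreeP3 : Graph m → Set
NoEqualDegreeP3 G = ∀ a d → JoinedByP3 G a d → ¬ (degree G a ≡ degree G d)

P3-degrees-differ : (G : Graph m) → NoEqualDegreeP3 G → ∀ {a b c d} →
                    a ≢ c → a ≢ d → b ≢ d → a ~[ G ] b → b ~[ G ] c → c ~[ G ] d →
                    degree G a ≢ degree G d
P3-degrees-differ G noP3 a≢c a≢d b≢d ab bc cd =
  noP3 _ _ (_ , _ , ~⇒≢ G ab , a≢c , a≢d , ~⇒≢ G bc , b≢d , ~⇒≢ G cd , ab , bc , cd)

∸≡suc⇒≡+ : ∀ a b {e} → a ∸ b ≡ suc e → a ≡ b + suc e
∸≡suc⇒≡+ a       zero    eq = eq
∸≡suc⇒≡+ (suc a) (suc b) eq = cong suc (∸≡suc⇒≡+ a b eq)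

2[X+s]≤2X+R⇒2s≤R : ∀ X s R → 2 * (X + s) ≤ 2 * X + R → 2 * s ≤ R
2[X+s]≤2X+R⇒2s≤R X s R le =
  +-cancelˡ-≤ (2 * X) (2 * s) R (subst (_≤ 2 * X + R) (*-distribˡ-+ 2 X s) le)

2t[1+t]≤3+2t⇒t≤1 : ∀ t → 2 * (t * suc t) ≤ 2 + suc (t + t) → t ≤ 1
2t[1+t]≤3+2t⇒t≤1 0             _  = z≤n
2t[1+t]≤3+2t⇒t≤1 1             _  = ≤-refl
2t[1+t]≤3+2t⇒t≤1 (suc (suc j)) le =
  ⊥-elim (m+1+n≰m (2 + suc (t + t)) (subst (_≤ 2 + suc (t + t)) (gap j) le))
  where
  t : ℕ
  t = suc (suc j)
  gap : ∀ j → let t = suc (suc j) in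
        2 * (t * suc t) ≡ 2 + suc (t + t) + suc (2 * j * j + 8 * j + 4)
  gap = solve-∀

4t[1+t]≤2t[1+2t]+2⇒t≤1 : ∀ t → 2 * (2 * (t * suc t)) ≤ (t + t) * suc (t + t) + 2 → t ≤ 1
4t[1+t]≤2t[1+2t]+2⇒t≤1 0             _  = z≤n
4t[1+t]≤2t[1+2t]+2⇒t≤1 1             _  = ≤-refl
4t[1+t]≤2t[1+2t]+2⇒t≤1 (suc (suc j)) le =
  ⊥-elim (m+1+n≰m ((t + t) * suc (t + t) + 2) (subst (_≤ (t + t) * suc (t + t) + 2) (gap j) le))
  where
  t : ℕ
  t = suc (suc j)
  gap : ∀ j → let t = suc (suc j) in
        2 * (2 * (t * suc t)) ≡ (t + t) * suc (t + t) + 2 + suc (2 * j + 1)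
  gap = solve-∀

module MaxDegreeVertex {m} (G : Graph m) (noP3 : NoEqualDegreeP3 G)
                       (v : Fin m) (v-max : ∀ w → degree G w ≤ degree G v) where

  open ≤-Reasoning

  deg : Fin m → ℕ
  deg = degree G

  D : ℕ
  D = deg v

  c : ℕ
  c = count (λ x → not (adj G v x))

  c+D≡m : c + D ≡ m
  c+D≡m = trans (cong (c +_) (degree≡count G v)) (count-not+count (adj G v))

  inner outer : Fin m → ℕ
  inner w = count (λ x → adj G w x ∧ adj G v x)
  outer w = count (λ x → adj G w x ∧ not (adj G v x))

  InnerNeighbours⊆ : Fin m → Fin m → Set
  InnerNeighbours⊆ w t = ∀ {x} → v ~[ G ] x → w ~[ G ] x → x ≡ t

  degree≡inner+outer : ∀ w → deg w ≡ inner w + outer w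
  degree≡inner+outer w = trans (degree≡count G w) (count-split (adj G w) (adj G v))

  outer≤c : ∀ w → outer w ≤ c
  outer≤c w = count-mono (λ x → T-∧ʳ {adj G w x})

  -- v itself is a non-neighbour of v that w does not see.
  outer<c : ∀ {w} → ¬ v ~[ G ] w → outer w < c
  outer<c {w} v≁w = count-mono-< v (λ x → T-∧ʳ {adj G w x})
    (λ w~v → v≁w (~-sym G (T-∧ˡ w~v)))
    (subst (T ∘ not) (sym (irrefl G v)) tt)

  inner≤1 : ∀ {w t} → InnerNeighbours⊆ w t → inner w ≤ 1
  inner≤1 {w} ⊆t = count-atMostOne (λ x → adj G w x ∧ adj G v x)
    (λ {x} {y} x≢y wx wy → x≢y (trans (⊆t (T-∧ʳ wx) (T-∧ˡ wx))
                                      (sym (⊆t (T-∧ʳ wy) (T-∧ˡ wy)))))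

  inner≡0 : ∀ {w} → (∀ {x} → v ~[ G ] x → ¬ w ~[ G ] x) → inner w ≡ 0
  inner≡0 {w} none = count-none (λ x wx → none (T-∧ʳ {adj G w x} wx) (T-∧ˡ wx))

  degree≤c : ∀ {w} → (∀ {x} → v ~[ G ] x → ¬ w ~[ G ] x) → deg w ≤ c
  degree≤c {w} none = begin
    deg w             ≡⟨ degree≡inner+outer w ⟩
    inner w + outer w ≡⟨ cong (_+ outer w) (inner≡0 none) ⟩
    outer w           ≤⟨ outer≤c w ⟩
    c                 ∎

  degree≤c+1 : ∀ {w t} → InnerNeighbours⊆ w t → deg w ≤ c + 1
  degree≤c+1 {w} ⊆t = begin
    deg w             ≡⟨ degree≡inner+outer w ⟩
    inner w + outer w ≡⟨ +-comm (inner w) (outer w) ⟩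
    outer w + inner w ≤⟨ +-mono-≤ (outer≤c w) (inner≤1 ⊆t) ⟩
    c + 1             ∎

  degree≤c-outside : ∀ {w t} → ¬ v ~[ G ] w → InnerNeighbours⊆ w t → deg w ≤ c
  degree≤c-outside {w} v≁w ⊆t = begin
    deg w             ≡⟨ degree≡inner+outer w ⟩
    inner w + outer w ≤⟨ +-monoˡ-≤ (outer w) (inner≤1 ⊆t) ⟩
    1 + outer w       ≤⟨ outer<c v≁w ⟩
    c                 ∎

  equal-degree-inner : ∀ {i j} → i ≢ j → v ~[ G ] i → v ~[ G ] j → deg i ≡ deg j →
                       InnerNeighbours⊆ i j
  equal-degree-inner {i} {j} i≢j v~i v~j di≡dj {x} v~x i~x with x ≟ j
  ... | yes x≡j = x≡j
  ... | no  x≢j = ⊥-elim (P3-degrees-differ G noP3 (x≢j ∘ sym) (i≢j ∘ sym) (~⇒≢ G v~i)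
                            (~-sym G v~j) v~x (~-sym G i~x) (sym di≡dj))

  max-degree-neighbour-inner : ∀ {w y} → w ≢ v → v ~[ G ] y → w ~[ G ] y → deg y ≡ D →
                               InnerNeighbours⊆ w y
  max-degree-neighbour-inner {w} {y} w≢v v~y w~y dy≡D {x} v~x w~x with x ≟ y
  ... | yes x≡y = x≡y
  ... | no  x≢y = ⊥-elim (P3-degrees-differ G noP3 (w≢v ∘ sym) (~⇒≢ G v~y) x≢y
                            v~x (~-sym G w~x) w~y (sym dy≡D))

  excess : Fin m → ℕ
  excess w = if adj G v w then deg w ∸ c else 0

  excess≡suc : ∀ {w e} → excess w ≡ suc e → v ~[ G ] w × deg w ≡ c + suc e
  excess≡suc {w} with adj G v w
  ... | true  = λ eq → tt , ∸≡suc⇒≡+ (deg w) c eq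
  ... | false = λ ()

  excess-nearlyInjective : NearlyInjective excess
  excess-nearlyInjective = once , twice
    where
    once : ∀ k → AtMostOne (λ i → excess i ≡ 2 + k)
    once k {i} {j} i≢j ei ej with excess≡suc ei | excess≡suc ej
    ... | v~i , di | v~j , dj =
      2+k≰1 (+-cancelˡ-≤ c _ _ (begin
        c + (2 + k) ≡⟨ di ⟨
        deg i       ≤⟨ degree≤c+1 (equal-degree-inner i≢j v~i v~j (trans di (sym dj))) ⟩
        c + 1       ∎))
      where
      2+k≰1 : ¬ 2 + k ≤ 1
      2+k≰1 (s≤s ())
    twice : AtMostTwo (λ i → excess i ≡ 1)
    twice {i} {j} {l} i≢j i≢l j≢l ei ej el with excess≡suc ei | excess≡suc ej | excess≡suc el
    ... | v~i , di | v~j , dj | v~l , dl = 1+c≰c (begin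
      c + 1 ≡⟨ di ⟨
      deg i ≤⟨ degree≤c no-inner ⟩
      c     ∎)
      where
      no-inner : ∀ {x} → v ~[ G ] x → ¬ i ~[ G ] x
      no-inner v~x i~x =
        j≢l (trans (sym (equal-degree-inner i≢j v~i v~j (trans di (sym dj)) v~x i~x))
                   (equal-degree-inner i≢l v~i v~l (trans di (sym dl)) v~x i~x))
      1+c≰c : ¬ c + 1 ≤ c
      1+c≰c = m+1+n≰m c

  base : Fin m → ℕ
  base w = if adj G v w then c else D

  ∑base : ∑ base ≡ 2 * (c * D)
  ∑base = begin-equality
    ∑ base                      ≡⟨ ∑-if (adj G v) c D ⟩
    count (adj G v) * c + c * D ≡⟨ cong (λ d → d * c + c * D) (degree≡count G v) ⟨
    D * c + c * D               ≡⟨ arithmetic c D ⟩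
    2 * (c * D)                 ∎
    where
    arithmetic : ∀ c D → D * c + c * D ≡ 2 * (c * D)
    arithmetic = solve-∀

  ∑deg≤2cD+∑excess : ∑ deg ≤ 2 * (c * D) + ∑ excess
  ∑deg≤2cD+∑excess = begin
    ∑ deg                        ≤⟨ ∑-mono pointwise ⟩
    ∑ (λ w → base w + excess w)  ≡⟨ ∑-distrib-+ base excess ⟩
    ∑ base + ∑ excess            ≡⟨ cong (_+ ∑ excess) ∑base ⟩
    2 * (c * D) + ∑ excess       ∎
    where
    pointwise : ∀ w → deg w ≤ base w + excess w
    pointwise w with adj G v w
    ... | true  = m≤n+m∸n (deg w) c
    ... | false = ≤-trans (v-max w) (m≤m+n D 0)

  excess≤ : ∀ {K} → D ≡ c + suc K → (∀ {y} → v ~[ G ] y → deg y ≢ D) → ∀ w → excess w ≤ K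
  excess≤ {K} D≡c+1+K not-max w with adj G v w in v~w
  ... | false = z≤n
  ... | true  = m≤n+o⇒m∸n≤o (deg w) c (≤-pred (begin-strict
    deg w       <⟨ ≤∧≢⇒< (v-max w) (not-max (T-≡true v~w)) ⟩
    D           ≡⟨ D≡c+1+K ⟩
    c + suc K   ≡⟨ +-suc c K ⟩
    suc (c + K) ∎))

  module WithMaxDegreeNeighbour {K} (D≡c+K : D ≡ c + K)
                                {y} (v~y : v ~[ G ] y) (dy≡D : deg y ≡ D) where

    excessNearY : Fin m → ℕ
    excessNearY w = if adj G y w then excess w else 0

    excessNearY≤1 : ∀ w → excessNearY w ≤ 1
    excessNearY≤1 w with adj G y w in y~w | adj G v w in v~w
    ... | false | _     = z≤n
    ... | true  | false = z≤n
    ... | true  | true  = m≤n+o⇒m∸n≤o (deg w) c (degree≤c+1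
      (max-degree-neighbour-inner (~⇒≢ G (T-≡true v~w) ∘ sym) v~y (~-sym G (T-≡true y~w)) dy≡D))

    excessNearY≡suc : ∀ {w e} → excessNearY w ≡ suc e → excess w ≡ suc e
    excessNearY≡suc {w} with adj G y w
    ... | true  = λ eq → eq
    ... | false = λ ()

    ∑excessNearY≤2 : ∑ excessNearY ≤ 2
    ∑excessNearY≤2 = ∑≤2 excessNearY excessNearY≤1 (λ x≢y x≢z y≢z ex ey ez →
      proj₂ excess-nearlyInjective x≢y x≢z y≢z
        (excessNearY≡suc ex) (excessNearY≡suc ey) (excessNearY≡suc ez))

    outsideNearY insideFarY : Fin m → Bool
    outsideNearY w = adj G y w ∧ not (adj G v w)
    insideFarY   w = adj G v w ∧ not (adj G y w)

    ∣outsideNearY∣≡∣insideFarY∣ : count outsideNearY ≡ count insideFarY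
    ∣outsideNearY∣≡∣insideFarY∣ = count-∖-sym (adj G y) (adj G v)
      (trans (sym (degree≡count G y)) (trans dy≡D (degree≡count G v)))

    isV : Fin m → Bool
    isV w = ⌊ v ≟ w ⌋

    ∣isV∣≤1 : count isV ≤ 1
    ∣isV∣≤1 = count-atMostOne isV
      (λ {a} {b} a≢b v≡a v≡b →
         a≢b (trans (sym (toWitness {a? = v ≟ a} v≡a)) (toWitness {a? = v ≟ b} v≡b)))

    K·[_] : (Fin m → Bool) → Fin m → ℕ
    K·[ p ] w = if p w then K else 0

    bound : Fin m → ℕ
    bound w = base w + K·[ insideFarY ] w + excessNearY w + K·[ isV ] w

    -- A vertex of A not adjacent to y may reach degree D = c + K, a neighbour of y outside A
    -- other than v has degree at most c = D − K; these two sets are equinumerous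
    -- (∣outsideNearY∣≡∣insideFarY∣), so the K's cancel after summation.
    pointwise : ∀ w → deg w + K·[ outsideNearY ] w ≤ bound w
    pointwise w with adj G v w in v~w | adj G y w in y~w
    ... | true  | true  = begin
      deg w + 0                                ≡⟨ +-identityʳ (deg w) ⟩
      deg w                                    ≤⟨ m≤n+m∸n (deg w) c ⟩
      c + (deg w ∸ c)                          ≡⟨ cong (_+ (deg w ∸ c)) (+-identityʳ c) ⟨
      c + 0 + (deg w ∸ c)                      ≤⟨ m≤m+n _ _ ⟩
      c + 0 + (deg w ∸ c) + K·[ isV ] w        ∎
    ... | true  | false = begin
      deg w + 0                                ≡⟨ +-identityʳ (deg w) ⟩
      deg w                                    ≤⟨ v-max w ⟩
      D                                        ≡⟨ trans D≡c+K (sym (+-identityʳ (c + K))) ⟩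
      c + K + 0                                ≤⟨ m≤m+n _ _ ⟩
      c + K + 0 + K·[ isV ] w                  ∎
    ... | false | false = begin
      deg w + 0                                ≡⟨ +-identityʳ (deg w) ⟩
      deg w                                    ≤⟨ v-max w ⟩
      D                                        ≡⟨ +-identityʳ D ⟨
      D + 0                                    ≡⟨ +-identityʳ (D + 0) ⟨
      D + 0 + 0                                ≤⟨ m≤m+n _ _ ⟩
      D + 0 + 0 + K·[ isV ] w                  ∎
    ... | false | true  with v ≟ w
    ...   | yes refl = +-monoˡ-≤ K (≤-reflexive (sym (trans (+-identityʳ (D + 0)) (+-identityʳ D))))
    ...   | no  v≢w  = begin
      deg w + K                                ≤⟨ +-monoˡ-≤ K (degree≤c-outside (subst T v~w) ⊆y) ⟩
      c + K                                    ≡⟨ D≡c+K ⟨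
      D                                        ≡⟨ +-identityʳ D ⟨
      D + 0                                    ≡⟨ +-identityʳ (D + 0) ⟨
      D + 0 + 0                                ≡⟨ +-identityʳ (D + 0 + 0) ⟨
      D + 0 + 0 + 0                            ∎
      where
      ⊆y : InnerNeighbours⊆ w y
      ⊆y = max-degree-neighbour-inner (v≢w ∘ sym) v~y (~-sym G (T-≡true y~w)) dy≡D

    ∑bound≤ : ∑ bound ≤ 2 * (c * D) + count insideFarY * K + 2 + 1 * K
    ∑bound≤ = begin
      ∑ bound
        ≡⟨ ∑-distrib-+ (λ w → base w + K·[ insideFarY ] w + excessNearY w) K·[ isV ] ⟩
      ∑ (λ w → base w + K·[ insideFarY ] w + excessNearY w) + ∑ K·[ isV ]
        ≡⟨ cong (_+ ∑ K·[ isV ]) (∑-distrib-+ (λ w → base w + K·[ insideFarY ] w) excessNearY) ⟩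
      ∑ (λ w → base w + K·[ insideFarY ] w) + ∑ excessNearY + ∑ K·[ isV ]
        ≡⟨ cong (λ s → s + ∑ excessNearY + ∑ K·[ isV ]) (∑-distrib-+ base K·[ insideFarY ]) ⟩
      ∑ base + ∑ K·[ insideFarY ] + ∑ excessNearY + ∑ K·[ isV ]
        ≡⟨ cong₂ (λ s r → s + r + ∑ excessNearY + ∑ K·[ isV ]) ∑base (∑-if-0 insideFarY K) ⟩
      2 * (c * D) + count insideFarY * K + ∑ excessNearY + ∑ K·[ isV ]
        ≤⟨ +-mono-≤ (+-monoʳ-≤ (2 * (c * D) + count insideFarY * K) ∑excessNearY≤2)
                    (≤-trans (≤-reflexive (∑-if-0 isV K)) (*-monoˡ-≤ K ∣isV∣≤1)) ⟩
      2 * (c * D) + count insideFarY * K + 2 + 1 * K ∎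

    ∑deg≤2cD+2+K : ∑ deg ≤ 2 * (c * D) + (2 + K)
    ∑deg≤2cD+2+K = +-cancelʳ-≤ (count insideFarY * K) (∑ deg) (2 * (c * D) + (2 + K)) (begin
      ∑ deg + count insideFarY * K
        ≡⟨ cong (λ r → ∑ deg + r * K) ∣outsideNearY∣≡∣insideFarY∣ ⟨
      ∑ deg + count outsideNearY * K
        ≡⟨ cong (∑ deg +_) (∑-if-0 outsideNearY K) ⟨
      ∑ deg + ∑ K·[ outsideNearY ]
        ≡⟨ ∑-distrib-+ deg K·[ outsideNearY ] ⟨
      ∑ (λ w → deg w + K·[ outsideNearY ] w)
        ≤⟨ ∑-mono pointwise ⟩
      ∑ bound
        ≤⟨ ∑bound≤ ⟩
      2 * (c * D) + count insideFarY * K + 2 + 1 * K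
        ≡⟨ arithmetic (2 * (c * D)) (count insideFarY) K ⟩
      2 * (c * D) + (2 + K) + count insideFarY * K ∎)
      where
      arithmetic : ∀ X r k → X + r * k + 2 + 1 * k ≡ X + (2 + k) + r * k
      arithmetic = solve-∀

  t≤1 : ∀ t → D ≡ c + suc (t + t) → 2 * (c * D + t * suc t) ≤ ∑ deg → t ≤ 1
  t≤1 t D≡c+1+2t ∑deg≥ with any? (λ y → T? (adj G v y) ×-dec (deg y ℕ.≟ D))
  ... | yes (y , v~y , dy≡D) = 2t[1+t]≤3+2t⇒t≤1 t
    (2[X+s]≤2X+R⇒2s≤R (c * D) (t * suc t) (2 + suc (t + t))
      (≤-trans ∑deg≥ (WithMaxDegreeNeighbour.∑deg≤2cD+2+K D≡c+1+2t v~y dy≡D)))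
  ... | no  ∄y = 4t[1+t]≤2t[1+2t]+2⇒t≤1 t (begin
    2 * (2 * (t * suc t))
      ≤⟨ *-monoʳ-≤ 2 (2[X+s]≤2X+R⇒2s≤R (c * D) (t * suc t) (∑ excess)
                       (≤-trans ∑deg≥ ∑deg≤2cD+∑excess)) ⟩
    2 * ∑ excess
      ≤⟨ ∑-nearlyInjective (t + t) excess excess≤t+t excess-nearlyInjective ⟩
    (t + t) * suc (t + t) + 2 ∎)
    where
    excess≤t+t : ∀ w → excess w ≤ t + t
    excess≤t+t = excess≤ D≡c+1+2t (λ v~y dy≡D → ∄y (_ , v~y , dy≡D))

c+[n+1+t]≡2n+1⇒n≡c+t : ∀ n c t → c + (n + 1 + t) ≡ 2 * n + 1 → n ≡ c + t
c+[n+1+t]≡2n+1⇒n≡c+t n c t eq =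
  +-cancelʳ-≡ (n + 1) n (c + t) (trans (e₁ n) (trans (sym eq) (e₂ c n t)))
  where
  e₁ : ∀ n → n + (n + 1) ≡ 2 * n + 1
  e₁ = solve-∀
  e₂ : ∀ c n t → c + (n + 1 + t) ≡ c + t + (n + 1)
  e₂ = solve-∀

[c+t][c+t+1]≡c[c+2t+1]+t[t+1] : ∀ c t →
  (c + t) * (c + t) + (c + t) ≡ c * (c + suc (t + t)) + t * suc t
[c+t][c+t+1]≡c[c+2t+1]+t[t+1] = solve-∀

c+t+1+t≡c+1+2t : ∀ c t → c + t + 1 + t ≡ c + suc (t + t)
c+t+1+t≡c+1+2t = solve-∀

maxDegreeVertex≤n+2 : ∀ n (G : Graph (2 * n + 1)) → n * n + n ≤ edgeCount G → NoEqualDegreeP3 G →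
                      ∀ v → (∀ w → degree G w ≤ degree G v) → degree G v ≤ n + 2
maxDegreeVertex≤n+2 n G edges noP3 v v-max with degree G v ≤? n + 1
... | yes D≤n+1 = ≤-trans D≤n+1 (+-monoʳ-≤ n (n≤1+n 1))
... | no  D≰n+1 with m≤n⇒∃[o]m+o≡n (≰⇒≥ D≰n+1)
...   | t , n+1+t≡D = begin
  D         ≡⟨ n+1+t≡D ⟨
  n + 1 + t ≤⟨ +-monoʳ-≤ (n + 1) (t≤1 t D≡c+1+2t ∑deg≥) ⟩
  n + 1 + 1 ≡⟨ +-assoc n 1 1 ⟩
  n + 2     ∎
  where
  open MaxDegreeVertex G noP3 v v-max
  open ≤-Reasoning
  n≡c+t : n ≡ c + t
  n≡c+t = c+[n+1+t]≡2n+1⇒n≡c+t n c t (trans (cong (c +_) n+1+t≡D) c+D≡m)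
  D≡c+1+2t : D ≡ c + suc (t + t)
  D≡c+1+2t = trans (sym n+1+t≡D) (trans (cong (λ x → x + 1 + t) n≡c+t) (c+t+1+t≡c+1+2t c t))
  n[n+1]≡cD+t[t+1] : n * n + n ≡ c * D + t * suc t
  n[n+1]≡cD+t[t+1] = trans (cong (λ x → x * x + x) n≡c+t)
    (trans ([c+t][c+t+1]≡c[c+2t+1]+t[t+1] c t) (cong (λ d → c * d + t * suc t) (sym D≡c+1+2t)))
  ∑deg≥ : 2 * (c * D + t * suc t) ≤ ∑ deg
  ∑deg≥ = begin
    2 * (c * D + t * suc t) ≡⟨ cong (2 *_) n[n+1]≡cD+t[t+1] ⟨
    2 * (n * n + n)         ≤⟨ *-monoʳ-≤ 2 edges ⟩
    2 * edgeCount G         ≡⟨ handshake G ⟨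
    ∑ deg                   ∎

maxDegree≤n+2 : ∀ n (G : Graph (2 * n + 1)) → n * n + n ≤ edgeCount G → NoEqualDegreeP3 G →
                maxDegree G ≤ n + 2
maxDegree≤n+2 n G edges noP3 with maxDegree-attained G
... | inj₁ Δ≡0          = subst (_≤ n + 2) (sym Δ≡0) z≤n
... | inj₂ (v , dv≡Δ) = subst (_≤ n + 2) dv≡Δ (maxDegreeVertex≤n+2 n G edges noP3 v
                          (λ w → subst (degree G w ≤_) (sym dv≡Δ) (degree≤maxDegree G w)))

[2M∸[2n+3]]²<8n : ∀ {M n} → M ≤ n + 2 → 1 ≤ n → (2 * M ∸ (2 * n + 3)) ^ 2 < 8 * n
[2M∸[2n+3]]²<8n {M} {n} M≤n+2 1≤n = begin-strict
  x ^ 2        ≡⟨ cong (x *_) (*-identityʳ x) ⟩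
  x * x        ≤⟨ *-mono-≤ x≤1 x≤1 ⟩
  1            <⟨ s≤s (s≤s z≤n) ⟩
  8 * 1        ≤⟨ *-monoʳ-≤ 8 1≤n ⟩
  8 * n        ∎
  where
  open ≤-Reasoning
  x : ℕ
  x = 2 * M ∸ (2 * n + 3)
  2[n+2]≡2n+3+1 : ∀ n → 2 * (n + 2) ≡ 2 * n + 3 + 1
  2[n+2]≡2n+3+1 = solve-∀
  x≤1 : x ≤ 1
  x≤1 = m≤n+o⇒m∸n≤o (2 * M) (2 * n + 3)
          (≤-trans (*-monoʳ-≤ 2 M≤n+2) (≤-reflexive (2[n+2]≡2n+3+1 n)))

-- Δ ≤ n + 2 holds without excluding K_{n,n+1} (whose maximum degree is n + 1), and n ≥ 1 suffices.
lemma2p3 : (n : ℕ) → 600 ≤ n → (G : Graph (2 * n + 1)) →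
    n * n + n ≤ edgeCount G →
    (∀ a d → JoinedByP3 G a d → ¬ (degree G a ≡ degree G d)) →
    ¬ IsKnn1 n G →
    (2 * maxDegree G ∸ (2 * n + 3)) ^ 2 < 8 * n
lemma2p3 n 600≤n G edges noP3 _ =
  [2M∸[2n+3]]²<8n (maxDegree≤n+2 n G edges noP3) (≤-trans (s≤s z≤n) 600≤n)
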